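{- Let $E$ be a $(\mathbf z,A)$-elation group of ${\rm PG}(r-1,p^h)$ of order $p^m$ having dimension $d=m/n$ over ${\rm GF}(p^n)$, and let $d'=h/n$. For each affine point $\mathbf x$ of ${\rm PG}(r-1,p^h)$ let $\Sigma_{\mathbf x}$ be the $d$-dimensional projective subspace of ${\rm PG}((r-1)d',p^n)$ spanned by $(\mathbf x^E)^*=\{\mathbf y^*:\mathbf y\in\mathbf x^E\}$. Then all the subspaces $\Sigma_{\mathbf x}$, as $\mathbf x$ ranges over the affine points, meet $\mathbf z^*$ in one and the same $(d-1)$-dimensional subspace.
   Context: Let $p$ be a prime, $h\ge1$, $r\ge2$. In ${\rm PG}(r-1,p^h)$ with homogeneous coordinates $(X_0,\ldots,X_{r-1})$ let $\mathbf z=(0,\ldots,0,1)$ and $A$ the hyperplane $X_0=0$; affine points are those not in $A$. For $\lambda\in{\rm GF}(p^h)$, $e_\lambda$ denotes the collineation $(x_0,\ldots,x_{r-1})\mapsto(x_0,\ldots,x_{r-2},x_{r-1}+\lambda x_0)$. A $(\mathbf z,A)$-elation group is $E=\{e_\lambda:\lambda\in H_E\}$ for an additive subgroup $H_E$ of ${\rm GF}(p^h)$; $\mathbf x^E$ denotes the $E$-orbit of $\mathbf x$. If ${\rm GF}(p^n)\subseteq{\rm GF}(p^h)$ and $H_E$ is a $d$-dimensional ${\rm GF}(p^n)$-subspace of ${\rm GF}(p^h)$, then $|E|=p^m$ with $m=nd$ and $E$ has dimension $d=m/n$ over ${\rm GF}(p^n)$. André/Bruck–Bose representation: with $d'=h/n$,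 fix a ${\rm GF}(p^n)$-basis of ${\rm GF}(p^h)$ and identify $x\in{\rm GF}(p^h)$ with its coordinate vector $(x_1,\ldots,x_{d'})$. In ${\rm PG}((r-1)d',p^n)$ use coordinates $(X_{00},X_{11},\ldots,X_{1d'},\ldots,X_{r-1,1},\ldots,X_{r-1,d'})$; an affine point $\mathbf x=(1,x_1,\ldots,x_{r-1})$ is mapped to $\mathbf x^*=(1,x_{11},\ldots,x_{1d'},\ldots,x_{r-1,1},\ldots,x_{r-1,d'})$. Let $A^*$ be the hyperplane $X_{00}=0$ and $\mathbf z^*$ the $(d'-1)$-dimensional subspace of $A^*$ given by $X_{00}=0$ and $X_{ij}=0$ for all $1\le i\le r-2$, $1\le j\le d'$. -}

module Defs where

open import Level using (Level; _⊔_)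
open import Algebra.Bundles using (CommutativeRing)
open import Data.Nat using (ℕ; zero; suc; _∸_; _≤_; s≤s; z≤n)
open import Data.Fin using (Fin; fromℕ; _≟_)
import Data.Fin as Fin
open import Data.Maybe using (Maybe; just; nothing)
open import Data.Product using (Σ; ∃; _×_; _,_)
open import Data.Unit using (⊤; tt)
open import Relation.Nullary using (¬_; yes; no)
open import Relation.Binary.PropositionalEquality using (_≡_)

-- Index of the last affine coordinate X_{r-1} among X_1,...,X_{r-1}
-- (these are indexed by Fin (r ∸ 1), index i standing for X_{i+1}).
lastIdx : ∀ {r} → 2 ≤ r → Fin (r ∸ 1)
lastIdx {suc (suc k)} (s≤s (s≤s z≤n)) = fromℕ k

-- Coordinate index set of PG((r-1)d', p^n):
-- nothing = X_00, just (i , j) = X_{i+1, j+1}.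
Idx : ℕ → ℕ → Set
Idx r d' = Maybe (Fin (r ∸ 1) × Fin d')

module FF {c ℓ : Level} (R : CommutativeRing c ℓ) where
  open CommutativeRing R renaming (Carrier to F)

  IsField : Set (c ⊔ ℓ)
  IsField = (¬ (1# ≈ 0#)) × (∀ x → ¬ (x ≈ 0#) → ∃ λ y → x * y ≈ 1#)

  HasSize : (F → Set ℓ) → ℕ → Set (c ⊔ ℓ)
  HasSize P k = Σ (Fin k → F) λ f →
    (∀ i → P (f i)) × (∀ i j → f i ≈ f j → i ≡ j) × (∀ x → P x → ∃ λ i → x ≈ f i)

  IsSubfield : (F → Set ℓ) → Set (c ⊔ ℓ)
  IsSubfield K = (∀ x y → x ≈ y → K x → K y) × K 0# × K 1#
    × (∀ x y → K x → K y → K (x + y)) × (∀ x y → K x → K y → K (x * y))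
    × (∀ x → K x → K (- x))
    × (∀ x y → K x → ¬ (x ≈ 0#) → x * y ≈ 1# → K y)

  sumF : ∀ {k} → (Fin k → F) → F
  sumF {zero} f = 0#
  sumF {suc k} f = f Fin.zero + sumF (λ j → f (Fin.suc j))

  module _ (K : F → Set ℓ) {I : Set} where
    SpanFam : ∀ {k} → (Fin k → I → F) → (I → F) → Set (c ⊔ ℓ)
    SpanFam {k} b v = Σ (Fin k → F) λ a → (∀ j → K (a j)) ×
      (∀ i → v i ≈ sumF (λ j → a j * b j i))

    Span : ((I → F) → Set (c ⊔ ℓ)) → (I → F) → Set (c ⊔ ℓ)
    Span S v = Σ ℕ λ k → Σ (Fin k → I → F) λ w → (∀ j → S (w j)) × SpanFam w v

    LinIndep : ∀ {k} → (Fin k → I → F) → Set (c ⊔ ℓ)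
    LinIndep {k} b = ∀ (a : Fin k → F) → (∀ j → K (a j)) →
      (∀ i → sumF (λ j → a j * b j i) ≈ 0#) → ∀ j → a j ≈ 0#

    -- W is a K-subspace of (vector) dimension k: it has a basis of size k
    HasDim : ((I → F) → Set (c ⊔ ℓ)) → ℕ → Set (c ⊔ ℓ)
    HasDim W k = Σ (Fin k → I → F) λ b → LinIndep b ×
      (∀ v → (W v → SpanFam b v) × (SpanFam b v → W v))

  asVec : F → ⊤ → F
  asVec x _ = x

  IsCoordinates : ∀ {d'} → (F → Set ℓ) → (Fin d' → F) → (F → Fin d' → F) → Set (c ⊔ ℓ)
  IsCoordinates K b co = LinIndep K (λ j → asVec (b j))
    × (∀ x j → K (co x j)) × (∀ x → x ≈ sumF (λ j → co x j * b j))

  HasDimF : (F → Set ℓ) → (F → Set ℓ) → ℕ → Set (c ⊔ ℓ)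
  HasDimF K H d = HasDim K {⊤} (λ v → Lift′ (H (v tt))) d
    where
    open import Level using (Lift; lift)
    Lift′ : Set ℓ → Set (c ⊔ ℓ)
    Lift′ A = Lift (c ⊔ ℓ) A

  module _ {r : ℕ} (r≥2 : 2 ≤ r) where
    -- affine points (1, x_1, ..., x_{r-1}) are given by x : Fin (r ∸ 1) → F

    elation : F → (Fin (r ∸ 1) → F) → (Fin (r ∸ 1) → F)
    elation λ' x i with i ≟ lastIdx r≥2
    ... | yes _ = x i + λ'
    ... | no _ = x i

    -- y ∈ x^E  where E = { e_λ : λ ∈ H }
    InOrbit : (F → Set ℓ) → (Fin (r ∸ 1) → F) → (Fin (r ∸ 1) → F) → Set (c ⊔ ℓ)
    InOrbit H x y = ∃ λ λ' → H λ' × (∀ i → y i ≈ elation λ' x i)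

    star : ∀ {d'} → (F → Fin d' → F) → (Fin (r ∸ 1) → F) → Idx r d' → F
    star co x nothing = 1#
    star co x (just (i , j)) = co (x i) j

    OrbitStar : ∀ {d'} → (F → Set ℓ) → (F → Fin d' → F) → (Fin (r ∸ 1) → F)
              → (Idx r d' → F) → Set (c ⊔ ℓ)
    OrbitStar H co x v = ∃ λ y → InOrbit H x y × (∀ i → v i ≈ star co y i)

    SigmaX : ∀ {d'} → (F → Set ℓ) → (F → Set ℓ) → (F → Fin d' → F)
           → (Fin (r ∸ 1) → F) → (Idx r d' → F) → Set (c ⊔ ℓ)
    SigmaX K H co x = Span K (OrbitStar H co x)

    Zstar : ∀ {d'} → (Idx r d' → F) → Set (c ⊔ ℓ)
    Zstar v = Lift (c ⊔ ℓ) (v nothing ≈ 0#) × (∀ i j → ¬ (i ≡ lastIdx r≥2) → v (just (i , j)) ≈ 0#)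
      where open import Level using (Lift)

-- Under the André/Bruck–Bose map the elation e_λ acts on x* as the translation by
-- the vector λ̂ carrying the coordinates of λ in the last block of coordinates and 0
-- elsewhere, and every λ̂ lies in z*. Hence (x^E)* = x* + Ĥ with Ĥ = {λ̂ : λ ∈ H_E},
-- and λ ↦ λ̂ is K-linear and injective, so Ĥ has dimension d. The span of x* + Ĥ is
-- ⟨x*⟩ ⊕ Ĥ, of dimension d + 1; since x* has X_00 = 1 while z* lies in X_00 = 0, its
-- intersection with z* is Ĥ, whatever x is.
module Submission where

open import Defs
open import Level using (Level; _⊔_)
open import Algebra.Bundles using (CommutativeRing)
open import Data.Nat using (ℕ; suc; _≤_; _*_; _^_)
open import Data.Nat.Primality using (Prime)
open import Data.Fin using (Fin)
open import Data.Product using (Σ; _×_)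
open import Data.Unit.Polymorphic using (⊤)
open import Relation.Binary.PropositionalEquality using (_≡_)

open import Level using (lift; lower)
import Data.Nat as ℕ
open import Data.Fin using (zero; suc; _≟_)
open import Data.Maybe using (just; nothing)
open import Data.Product using (_,_; proj₁; proj₂)
open import Data.Unit using (tt)
open import Data.Vec.Functional using (_∷_)
open import Relation.Nullary using (¬_; yes; no)
open import Relation.Nullary.Negation using (contradiction)
import Relation.Binary.PropositionalEquality as ≡

module LinearAlgebra {c ℓ : Level} (R : CommutativeRing c ℓ) where
  open CommutativeRing R hiding (zero) renaming (Carrier to F; _*_ to _·_)
  open FF R
  open import Algebra.Properties.Ring ring using (-‿distribˡ-*; -‿+-comm; -0#≈0#; x∙y⁻¹≈ε⇒x≈y)
  open import Algebra.Properties.Semiring.Sum semiring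
    using (sum; sum-cong-≋; sum-replicate-zero; ∑-distrib-+; ∑-comm; *-distribˡ-sum; *-distribʳ-sum)
  open import Relation.Binary.Reasoning.Setoid setoid

  sumF≡sum : ∀ {k} (f : Fin k → F) → sumF f ≡ sum f
  sumF≡sum {ℕ.zero} f = ≡.refl
  sumF≡sum {ℕ.suc k} f = ≡.cong (f zero +_) (sumF≡sum (λ j → f (suc j)))

  sumF≈sum : ∀ {k} (f : Fin k → F) → sumF f ≈ sum f
  sumF≈sum f = reflexive (sumF≡sum f)

  sumF-cong : ∀ {k} {f g : Fin k → F} → (∀ j → f j ≈ g j) → sumF f ≈ sumF g
  sumF-cong {f = f} {g} f≈g rewrite sumF≡sum f | sumF≡sum g = sum-cong-≋ f≈g

  sumF-zero : ∀ {k} {f : Fin k → F} → (∀ j → f j ≈ 0#) → sumF f ≈ 0#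
  sumF-zero {k} {f} f≈0 rewrite sumF≡sum f = trans (sum-cong-≋ f≈0) (sum-replicate-zero k)

  sumF-distrib-+ : ∀ {k} (f g : Fin k → F) → sumF (λ j → f j + g j) ≈ sumF f + sumF g
  sumF-distrib-+ f g rewrite sumF≡sum (λ j → f j + g j) | sumF≡sum f | sumF≡sum g = ∑-distrib-+ f g

  *-distribˡ-sumF : ∀ {k} x (f : Fin k → F) → x · sumF f ≈ sumF (λ j → x · f j)
  *-distribˡ-sumF x f rewrite sumF≡sum f | sumF≡sum (λ j → x · f j) = *-distribˡ-sum x f

  *-distribʳ-sumF : ∀ {k} x (f : Fin k → F) → sumF f · x ≈ sumF (λ j → f j · x)
  *-distribʳ-sumF x f rewrite sumF≡sum f | sumF≡sum (λ j → f j · x) = *-distribʳ-sum x f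

  sumF-comm : ∀ {m k} (f : Fin m → Fin k → F) →
            sumF (λ i → sumF (f i)) ≈ sumF (λ j → sumF (λ i → f i j))
  sumF-comm f = begin
    sumF (λ i → sumF (f i))          ≈⟨ sumF-cong (λ i → sumF≈sum (f i)) ⟩
    sumF (λ i → sum (f i))           ≈⟨ sumF≈sum (λ i → sum (f i)) ⟩
    sum (λ i → sum (f i))            ≈⟨ ∑-comm f ⟩
    sum (λ j → sum (λ i → f i j))    ≈⟨ sumF≈sum (λ j → sum (λ i → f i j)) ⟨
    sumF (λ j → sum (λ i → f i j))   ≈⟨ sumF-cong (λ j → sumF≈sum (λ i → f i j)) ⟨
    sumF (λ j → sumF (λ i → f i j))  ∎

  -‿distrib-sumF : ∀ {k} (f : Fin k → F) → sumF (λ j → - f j) ≈ - sumF f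
  -‿distrib-sumF {ℕ.zero} f = sym -0#≈0#
  -‿distrib-sumF {ℕ.suc k} f = trans (+-congˡ (-‿distrib-sumF (λ j → f (suc j)))) (-‿+-comm _ _)

  δ : ∀ {k} → Fin k → Fin k → F
  δ zero zero = 1#
  δ zero (suc _) = 0#
  δ (suc _) zero = 0#
  δ (suc i) (suc j) = δ i j

  sumF-δ : ∀ {k} (i : Fin k) (g : Fin k → F) → sumF (λ j → δ i j · g j) ≈ g i
  sumF-δ zero g = trans (+-cong (*-identityˡ _) (sumF-zero (λ j → zeroˡ (g (suc j))))) (+-identityʳ _)
  sumF-δ (suc i) g = trans (+-cong (zeroˡ _) (sumF-δ i (λ j → g (suc j)))) (+-identityˡ _)

  module Subfield {K : F → Set ℓ} (K-subfield : IsSubfield K) where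

    K-0 : K 0#
    K-0 = proj₁ (proj₂ K-subfield)

    K-1 : K 1#
    K-1 = proj₁ (proj₂ (proj₂ K-subfield))

    K-+ : ∀ x y → K x → K y → K (x + y)
    K-+ = proj₁ (proj₂ (proj₂ (proj₂ K-subfield)))

    K-· : ∀ x y → K x → K y → K (x · y)
    K-· = proj₁ (proj₂ (proj₂ (proj₂ (proj₂ K-subfield))))

    K-neg : ∀ x → K x → K (- x)
    K-neg = proj₁ (proj₂ (proj₂ (proj₂ (proj₂ (proj₂ K-subfield)))))

    K-sumF : ∀ {k} (f : Fin k → F) → (∀ j → K (f j)) → K (sumF f)
    K-sumF {ℕ.zero} f _ = K-0
    K-sumF {ℕ.suc k} f Kf = K-+ _ _ (Kf zero) (K-sumF (λ j → f (suc j)) (λ j → Kf (suc j)))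

    K-δ : ∀ {k} (i j : Fin k) → K (δ i j)
    K-δ zero zero = K-1
    K-δ zero (suc _) = K-0
    K-δ (suc _) zero = K-0
    K-δ (suc i) (suc j) = K-δ i j

  drop-zero-head : ∀ {I : Set} {k} {v₀ : I → F} {ε : Fin k → I → F} (a : Fin (suc k) → F) → a zero ≈ 0# →
                   ∀ i → sumF (λ j → a j · (v₀ ∷ ε) j i) ≈ sumF (λ j → a (suc j) · ε j i)
  drop-zero-head a a₀≈0 i = trans (+-congʳ (trans (*-congʳ a₀≈0) (zeroˡ _))) (+-identityˡ _)

  module Spans {K : F → Set ℓ} (K-subfield : IsSubfield K) {I : Set} where
    open Subfield K-subfield

    SpanFam-zero : ∀ {k} (b : Fin k → I → F) → SpanFam K b (λ _ → 0#)
    SpanFam-zero b = (λ _ → 0#) , (λ _ → K-0) , λ i → sym (sumF-zero (λ j → zeroˡ (b j i)))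

    SpanFam-member : ∀ {k} (b : Fin k → I → F) (j : Fin k) → SpanFam K b (b j)
    SpanFam-member b j = δ j , K-δ j , λ i → sym (sumF-δ j (λ l → b l i))

    SpanFam-vanishing : ∀ {k} {b : Fin k → I → F} {v : I → F} i →
                        (∀ j → b j i ≈ 0#) → SpanFam K b v → v i ≈ 0#
    SpanFam-vanishing i b≈0 (a , _ , v≈) =
      trans (v≈ i) (sumF-zero (λ j → trans (*-congˡ (b≈0 j)) (zeroʳ (a j))))

    SpanFam-trans : ∀ {k m} {b : Fin k → I → F} {w : Fin m → I → F} {v : I → F} →
                    (∀ j → SpanFam K b (w j)) → SpanFam K w v → SpanFam K b v
    SpanFam-trans {k} {m} {b} {w} w∈ (a , Ka , v≈) = e , Ke , λ i → trans (v≈ i) (regroup i)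
      where
      A : Fin m → Fin k → F
      A j = proj₁ (w∈ j)
      e : Fin k → F
      e l = sumF (λ j → a j · A j l)
      Ke : ∀ l → K (e l)
      Ke l = K-sumF _ (λ j → K-· _ _ (Ka j) (proj₁ (proj₂ (w∈ j)) l))
      regroup : ∀ i → sumF (λ j → a j · w j i) ≈ sumF (λ l → e l · b l i)
      regroup i = begin
        sumF (λ j → a j · w j i)
          ≈⟨ sumF-cong (λ j → *-congˡ (proj₂ (proj₂ (w∈ j)) i)) ⟩
        sumF (λ j → a j · sumF (λ l → A j l · b l i))
          ≈⟨ sumF-cong (λ j → *-distribˡ-sumF (a j) (λ l → A j l · b l i)) ⟩
        sumF (λ j → sumF (λ l → a j · (A j l · b l i)))
          ≈⟨ sumF-cong (λ j → sumF-cong (λ l → sym (*-assoc (a j) (A j l) (b l i)))) ⟩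
        sumF (λ j → sumF (λ l → a j · A j l · b l i))
          ≈⟨ sumF-comm (λ j l → a j · A j l · b l i) ⟩
        sumF (λ l → sumF (λ j → a j · A j l · b l i))
          ≈⟨ sumF-cong (λ l → *-distribʳ-sumF (b l i) (λ j → a j · A j l)) ⟨
        sumF (λ l → e l · b l i) ∎

    Span⇒SpanFam : ∀ {k} {b : Fin k → I → F} {S : (I → F) → Set (c ⊔ ℓ)} {v : I → F} →
                   (∀ w → S w → SpanFam K b w) → Span K S v → SpanFam K b v
    Span⇒SpanFam S⊆ (_ , w , w∈S , v∈) = SpanFam-trans (λ j → S⊆ (w j) (w∈S j)) v∈

    LinIndep⇒coefficients-unique : ∀ {k} {b : Fin k → I → F} → LinIndep K b →
      (c₁ c₂ : Fin k → F) → (∀ j → K (c₁ j)) → (∀ j → K (c₂ j)) →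
      (∀ i → sumF (λ j → c₁ j · b j i) ≈ sumF (λ j → c₂ j · b j i)) → ∀ j → c₁ j ≈ c₂ j
    LinIndep⇒coefficients-unique {b = b} indep c₁ c₂ Kc₁ Kc₂ same j =
      x∙y⁻¹≈ε⇒x≈y _ _
        (indep (λ j → c₁ j + - c₂ j) (λ j → K-+ _ _ (Kc₁ j) (K-neg _ (Kc₂ j))) difference j)
      where
      difference : ∀ i → sumF (λ j → (c₁ j + - c₂ j) · b j i) ≈ 0#
      difference i = begin
        sumF (λ j → (c₁ j + - c₂ j) · b j i)
          ≈⟨ sumF-cong (λ j → trans (distribʳ (b j i) (c₁ j) (- c₂ j))
                                     (+-congˡ (sym (-‿distribˡ-* (c₂ j) (b j i))))) ⟩
        sumF (λ j → c₁ j · b j i + - (c₂ j · b j i))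
          ≈⟨ sumF-distrib-+ (λ j → c₁ j · b j i) (λ j → - (c₂ j · b j i)) ⟩
        sumF (λ j → c₁ j · b j i) + sumF (λ j → - (c₂ j · b j i))
          ≈⟨ +-cong (same i) (-‿distrib-sumF (λ j → c₂ j · b j i)) ⟩
        sumF (λ j → c₂ j · b j i) + - sumF (λ j → c₂ j · b j i)
          ≈⟨ -‿inverseʳ _ ⟩
        0# ∎

    SpanFam-∷⁺ : ∀ {k} {v₀ : I → F} {ε : Fin k → I → F} {v : I → F} →
                 SpanFam K ε v → SpanFam K (v₀ ∷ ε) v
    SpanFam-∷⁺ {v₀ = v₀} {ε} (a , Ka , v≈) =
      (0# ∷ a) , (λ { zero → K-0 ; (suc j) → Ka j }) ,
      λ i → trans (v≈ i) (sym (drop-zero-head {v₀ = v₀} {ε} (0# ∷ a) refl i))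

    SpanFam-∷⇒Span : ∀ {k} {v₀ : I → F} {ε : Fin k → I → F} {S : (I → F) → Set (c ⊔ ℓ)} {v} →
                     S v₀ → (∀ j → S (λ i → v₀ i + ε j i)) → SpanFam K (v₀ ∷ ε) v → Span K S v
    SpanFam-∷⇒Span {k} {v₀} {ε} Sv₀ Sv₀+ε (a , Ka , v≈) =
      suc k , v₀ ∷ (λ j i → v₀ i + ε j i) , (λ { zero → Sv₀ ; (suc j) → Sv₀+ε j }) ,
      coeff , (λ { zero → K-+ _ _ (Ka zero) (K-neg _ (K-sumF _ (λ j → Ka (suc j))))
                 ; (suc j) → Ka (suc j) }) ,
      λ i → trans (v≈ i) (sym (regroup i))
      where
      s : F
      s = sumF (λ j → a (suc j))
      coeff : Fin (suc k) → F
      coeff = (a zero + - s) ∷ (λ j → a (suc j))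
      a₀-s+s≈a₀ : a zero + - s + s ≈ a zero
      a₀-s+s≈a₀ = trans (+-assoc _ _ _) (trans (+-congˡ (-‿inverseˡ s)) (+-identityʳ _))
      regroup : ∀ i → (a zero + - s) · v₀ i + sumF (λ j → a (suc j) · (v₀ i + ε j i))
                      ≈ a zero · v₀ i + sumF (λ j → a (suc j) · ε j i)
      regroup i = begin
        (a zero + - s) · v₀ i + sumF (λ j → a (suc j) · (v₀ i + ε j i))
          ≈⟨ +-congˡ (trans (sumF-cong (λ j → distribˡ (a (suc j)) (v₀ i) (ε j i)))
                             (sumF-distrib-+ (λ j → a (suc j) · v₀ i) (λ j → a (suc j) · ε j i))) ⟩
        (a zero + - s) · v₀ i + (sumF (λ j → a (suc j) · v₀ i) + sumF (λ j → a (suc j) · ε j i))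
          ≈⟨ +-congˡ (+-congʳ (*-distribʳ-sumF (v₀ i) (λ j → a (suc j)))) ⟨
        (a zero + - s) · v₀ i + (s · v₀ i + sumF (λ j → a (suc j) · ε j i))
          ≈⟨ +-assoc _ _ _ ⟨
        (a zero + - s) · v₀ i + s · v₀ i + sumF (λ j → a (suc j) · ε j i)
          ≈⟨ +-congʳ (trans (sym (distribʳ (v₀ i) _ _)) (*-congʳ a₀-s+s≈a₀)) ⟩
        a zero · v₀ i + sumF (λ j → a (suc j) · ε j i) ∎

    module Pivot {k} {v₀ : I → F} {ε : Fin k → I → F} (i₀ : I)
                 (v₀≈1 : v₀ i₀ ≈ 1#) (ε≈0 : ∀ j → ε j i₀ ≈ 0#) where

      coefficient-at-pivot : (a : Fin (suc k) → F) → sumF (λ j → a j · (v₀ ∷ ε) j i₀) ≈ a zero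
      coefficient-at-pivot a = begin
        a zero · v₀ i₀ + sumF (λ j → a (suc j) · ε j i₀)
          ≈⟨ +-cong (*-congˡ v₀≈1) (sumF-zero (λ j → trans (*-congˡ (ε≈0 j)) (zeroʳ (a (suc j))))) ⟩
        a zero · 1# + 0#  ≈⟨ +-identityʳ (a zero · 1#) ⟩
        a zero · 1#       ≈⟨ *-identityʳ (a zero) ⟩
        a zero            ∎

      LinIndep-∷ : LinIndep K ε → LinIndep K (v₀ ∷ ε)
      LinIndep-∷ indep a Ka a·b≈0 = λ { zero → a₀≈0 ; (suc j) → tail≈0 j }
        where
        a₀≈0 : a zero ≈ 0#
        a₀≈0 = trans (sym (coefficient-at-pivot a)) (a·b≈0 i₀)
        tail≈0 : ∀ j → a (suc j) ≈ 0#
        tail≈0 = indep (λ j → a (suc j)) (λ j → Ka (suc j))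
                       (λ i → trans (sym (drop-zero-head {v₀ = v₀} {ε} a a₀≈0 i)) (a·b≈0 i))

      SpanFam-∷⁻ : ∀ {v : I → F} → SpanFam K (v₀ ∷ ε) v → v i₀ ≈ 0# → SpanFam K ε v
      SpanFam-∷⁻ (a , Ka , v≈) v≈0 =
        (λ j → a (suc j)) , (λ j → Ka (suc j)) ,
        λ i → trans (v≈ i) (drop-zero-head {v₀ = v₀} {ε} a a₀≈0 i)
        where
        a₀≈0 : a zero ≈ 0#
        a₀≈0 = trans (sym (coefficient-at-pivot a)) (trans (sym (v≈ i₀)) v≈0)

  module Coordinates {d' : ℕ} {K : F → Set ℓ} (K-subfield : IsSubfield K)
                     {b : Fin d' → F} {co : F → Fin d' → F} (coordinates : IsCoordinates K b co) where
    open Subfield K-subfield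
    open Spans K-subfield

    co-K : ∀ x j → K (co x j)
    co-K = proj₁ (proj₂ coordinates)

    co-expansion : ∀ x → x ≈ sumF (λ j → co x j · b j)
    co-expansion = proj₂ (proj₂ coordinates)

    SpanFam-coordinates : ∀ x → SpanFam K (λ j → asVec (b j)) (asVec x)
    SpanFam-coordinates x = co x , co-K x , λ _ → co-expansion x

    co-unique : ∀ {x} (c : Fin d' → F) → (∀ j → K (c j)) → x ≈ sumF (λ j → c j · b j) →
                ∀ j → co x j ≈ c j
    co-unique {x} c Kc x≈ = LinIndep⇒coefficients-unique (proj₁ coordinates) (co x) c (co-K x) Kc
                                                          (λ _ → trans (sym (co-expansion x)) x≈)

    co-cong : ∀ {x y} → x ≈ y → ∀ j → co x j ≈ co y j
    co-cong {y = y} x≈y = co-unique (co y) (co-K y) (trans x≈y (co-expansion y))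

    co-+ : ∀ x y j → co (x + y) j ≈ co x j + co y j
    co-+ x y = co-unique (λ j → co x j + co y j) (λ j → K-+ _ _ (co-K x j) (co-K y j)) (begin
      x + y
        ≈⟨ +-cong (co-expansion x) (co-expansion y) ⟩
      sumF (λ j → co x j · b j) + sumF (λ j → co y j · b j)
        ≈⟨ sumF-distrib-+ (λ j → co x j · b j) (λ j → co y j · b j) ⟨
      sumF (λ j → co x j · b j + co y j · b j)
        ≈⟨ sumF-cong (λ j → distribʳ (b j) (co x j) (co y j)) ⟨
      sumF (λ j → (co x j + co y j) · b j) ∎)

    -- The coordinates of Σ a_l u_l are read off the expansion that SpanFam-trans
    -- computes from the expansions of the u_l.
    co-combination : ∀ {k} (a u : Fin k → F) → (∀ l → K (a l)) →
                     ∀ j → co (sumF (λ l → a l · u l)) j ≈ sumF (λ l → a l · co (u l) j)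
    co-combination a u Ka = co-unique _ (proj₁ (proj₂ expansion)) (proj₂ (proj₂ expansion) tt)
      where
      expansion : SpanFam K (λ j → asVec (b j)) (asVec (sumF (λ l → a l · u l)))
      expansion = SpanFam-trans (λ l → SpanFam-coordinates (u l)) (a , Ka , λ _ → refl)

    co-LinIndep : ∀ {k} {u : Fin k → F} → LinIndep K (λ l → asVec (u l)) →
                  LinIndep K (λ l j → co (u l) j)
    co-LinIndep {u = u} indep a Ka co-vanish = indep a Ka (λ _ → begin
      sumF (λ l → a l · u l)
        ≈⟨ co-expansion _ ⟩
      sumF (λ j → co (sumF (λ l → a l · u l)) j · b j)
        ≈⟨ sumF-zero (λ j → trans (*-congʳ (trans (co-combination a u Ka j) (co-vanish j)))
                                  (zeroˡ (b j))) ⟩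
      0# ∎)

module AndréBruckBose {c ℓ : Level} (R : CommutativeRing c ℓ) {r d' d : ℕ} (r≥2 : 2 ≤ r)
  {K : CommutativeRing.Carrier R → Set ℓ} (K-subfield : FF.IsSubfield R K)
  {b : Fin d' → CommutativeRing.Carrier R}
  {co : CommutativeRing.Carrier R → Fin d' → CommutativeRing.Carrier R}
  (coordinates : FF.IsCoordinates R K b co)
  (H : CommutativeRing.Carrier R → Set ℓ) (H-dim : FF.HasDimF R K H d) where

  open CommutativeRing R hiding (zero) renaming (Carrier to F; _*_ to _·_)
  open FF R
  open LinearAlgebra R
  open Subfield K-subfield
  open Spans K-subfield
  open Coordinates K-subfield coordinates
  open import Relation.Binary.Reasoning.Setoid setoid

  -- zVec λ is the vector λ̂ of z* by which e_λ translates the points x*.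
  zVec : F → Idx r d' → F
  zVec u nothing = 0#
  zVec u (just (i , j)) with i ≟ lastIdx r≥2
  ... | yes _ = co u j
  ... | no _ = 0#

  zVec-last : ∀ u j → zVec u (just (lastIdx r≥2 , j)) ≡ co u j
  zVec-last u j with lastIdx r≥2 ≟ lastIdx r≥2
  ... | yes _ = ≡.refl
  ... | no ≢ = contradiction ≡.refl ≢

  zVec-other : ∀ u {i} j → ¬ i ≡ lastIdx r≥2 → zVec u (just (i , j)) ≡ 0#
  zVec-other u {i} j i≢ with i ≟ lastIdx r≥2
  ... | yes i≡ = contradiction i≡ i≢
  ... | no _ = ≡.refl

  zVec-cong : ∀ {u w} → u ≈ w → ∀ i → zVec u i ≈ zVec w i
  zVec-cong u≈w nothing = refl
  zVec-cong u≈w (just (i , j)) with i ≟ lastIdx r≥2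
  ... | yes _ = co-cong u≈w j
  ... | no _ = refl

  zVec-combination : ∀ {k} (a u : Fin k → F) → (∀ l → K (a l)) →
                     ∀ i → zVec (sumF (λ l → a l · u l)) i ≈ sumF (λ l → a l · zVec (u l) i)
  zVec-combination a u Ka nothing = sym (sumF-zero (λ l → zeroʳ (a l)))
  zVec-combination a u Ka (just (i , j)) with i ≟ lastIdx r≥2
  ... | yes _ = co-combination a u Ka j
  ... | no _ = sym (sumF-zero (λ l → zeroʳ (a l)))

  star-cong : ∀ {x y} → (∀ i → x i ≈ y i) → ∀ i → star r≥2 co x i ≈ star r≥2 co y i
  star-cong x≈y nothing = refl
  star-cong x≈y (just (i , j)) = co-cong (x≈y i) j

  star-elation : ∀ u x i → star r≥2 co (elation r≥2 u x) i ≈ star r≥2 co x i + zVec u i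
  star-elation u x nothing = sym (+-identityʳ 1#)
  star-elation u x (just (i , j)) with i ≟ lastIdx r≥2
  ... | yes _ = co-+ (x i) u j
  ... | no _ = sym (+-identityʳ _)

  elation-zero : ∀ x i → x i ≈ elation r≥2 0# x i
  elation-zero x i with i ≟ lastIdx r≥2
  ... | yes _ = sym (+-identityʳ _)
  ... | no _ = refl

  β : Fin d → F
  β k = proj₁ H-dim k tt

  H⇒SpanFam : ∀ {u} → H u → SpanFam K (λ k → asVec (β k)) (asVec u)
  H⇒SpanFam {u} Hu = proj₁ (proj₂ (proj₂ H-dim) (asVec u)) (lift Hu)

  H-0 : H 0#
  H-0 = lower (proj₂ (proj₂ (proj₂ H-dim) (asVec 0#)) (SpanFam-zero (proj₁ H-dim)))

  H-β : ∀ k → H (β k)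
  H-β k = lower (proj₂ (proj₂ (proj₂ H-dim) (asVec (β k))) (SpanFam-member (proj₁ H-dim) k))

  zBasis : Fin d → Idx r d' → F
  zBasis k = zVec (β k)

  zBasis-LinIndep : LinIndep K zBasis
  zBasis-LinIndep a Ka vanish = co-LinIndep (proj₁ (proj₂ H-dim)) a Ka λ j → begin
    sumF (λ k → a k · co (β k) j)
      ≈⟨ sumF-cong (λ k → *-congˡ (reflexive (zVec-last (β k) j))) ⟨
    sumF (λ k → a k · zBasis k (just (lastIdx r≥2 , j)))
      ≈⟨ vanish (just (lastIdx r≥2 , j)) ⟩
    0# ∎

  SpanFam-zBasis-dim : HasDim K (SpanFam K zBasis) d
  SpanFam-zBasis-dim = zBasis , zBasis-LinIndep , λ v → (λ w → w) , (λ w → w)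

  OrbitStar⊆SpanFam : ∀ x v → OrbitStar r≥2 H co x v → SpanFam K (star r≥2 co x ∷ zBasis) v
  OrbitStar⊆SpanFam x v (y , (u , Hu , y≈) , v≈) with H⇒SpanFam Hu
  ... | a , Ka , u≈ = (1# ∷ a) , (λ { zero → K-1 ; (suc k) → Ka k }) , λ i → begin
    v i                              ≈⟨ v≈ i ⟩
    star r≥2 co y i                  ≈⟨ star-cong y≈ i ⟩
    star r≥2 co (elation r≥2 u x) i  ≈⟨ star-elation u x i ⟩
    star r≥2 co x i + zVec u i
      ≈⟨ +-cong (sym (*-identityˡ _)) (trans (zVec-cong (u≈ tt) i) (zVec-combination a β Ka i)) ⟩
    1# · star r≥2 co x i + sumF (λ k → a k · zBasis k i) ∎

  star∈OrbitStar : ∀ x → OrbitStar r≥2 H co x (star r≥2 co x)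
  star∈OrbitStar x = x , (0# , H-0 , elation-zero x) , λ _ → refl

  star+zBasis∈OrbitStar : ∀ x k → OrbitStar r≥2 H co x (λ i → star r≥2 co x i + zBasis k i)
  star+zBasis∈OrbitStar x k =
    elation r≥2 (β k) x , (β k , H-β k , λ _ → refl) , λ i → sym (star-elation (β k) x i)

  SigmaX⇒SpanFam : ∀ x {v} → SigmaX r≥2 K H co x v → SpanFam K (star r≥2 co x ∷ zBasis) v
  SigmaX⇒SpanFam x =
    Span⇒SpanFam {b = star r≥2 co x ∷ zBasis} {S = OrbitStar r≥2 H co x} (OrbitStar⊆SpanFam x)

  SpanFam⇒SigmaX : ∀ x {v} → SpanFam K (star r≥2 co x ∷ zBasis) v → SigmaX r≥2 K H co x v
  SpanFam⇒SigmaX x =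
    SpanFam-∷⇒Span {S = OrbitStar r≥2 H co x} (star∈OrbitStar x) (star+zBasis∈OrbitStar x)

  module X00-pivot (x : Fin (r ℕ.∸ 1) → F) =
    Pivot {v₀ = star r≥2 co x} {ε = zBasis} nothing refl (λ _ → refl)

  SigmaX-dim : ∀ x → HasDim K (SigmaX r≥2 K H co x) (suc d)
  SigmaX-dim x = star r≥2 co x ∷ zBasis , X00-pivot.LinIndep-∷ x zBasis-LinIndep ,
    λ v → SigmaX⇒SpanFam x , SpanFam⇒SigmaX x

  SigmaX∩Zstar⇔SpanFam-zBasis : ∀ x v →
    (SigmaX r≥2 K H co x v × Zstar r≥2 v → SpanFam K zBasis v)
    × (SpanFam K zBasis v → SigmaX r≥2 K H co x v × Zstar r≥2 v)
  SigmaX∩Zstar⇔SpanFam-zBasis x v = in-zBasis , in-SigmaX∩Zstar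
    where
    in-zBasis : SigmaX r≥2 K H co x v × Zstar r≥2 v → SpanFam K zBasis v
    in-zBasis (σ , lift v₀≈0 , _) = X00-pivot.SpanFam-∷⁻ x (SigmaX⇒SpanFam x σ) v₀≈0
    in-SigmaX∩Zstar : SpanFam K zBasis v → SigmaX r≥2 K H co x v × Zstar r≥2 v
    in-SigmaX∩Zstar w = SpanFam⇒SigmaX x (SpanFam-∷⁺ w) ,
      lift (SpanFam-vanishing nothing (λ _ → refl) w) ,
      λ i j i≢ → SpanFam-vanishing (just (i , j)) (λ k → reflexive (zVec-other (β k) j i≢)) w

-- The field, primality and size hypotheses are unused: the argument only needs K to be
-- a subring of R over which b is a basis.
lemma3 : ∀ {c ℓ : Level} (R : CommutativeRing c ℓ) → FF.IsField R →
    (p h n d' d r : ℕ) → Prime p → 1 ≤ n → 1 ≤ h → h ≡ n * d' →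
    FF.HasSize R (λ _ → ⊤) (p ^ h) →
    (K : CommutativeRing.Carrier R → Set ℓ) → FF.IsSubfield R K → FF.HasSize R K (p ^ n) →
    (b : Fin d' → CommutativeRing.Carrier R) (co : CommutativeRing.Carrier R → Fin d' → CommutativeRing.Carrier R) →
    FF.IsCoordinates R K b co →
    (H : CommutativeRing.Carrier R → Set ℓ) → FF.HasDimF R K H d →
    (r≥2 : 2 ≤ r) →
    (∀ x → FF.HasDim R K (FF.SigmaX R r≥2 K H co x) (suc d))
    × Σ ((Idx r d' → CommutativeRing.Carrier R) → Set (c ⊔ ℓ)) (λ W →
        FF.HasDim R K W d
        × (∀ x v → ((FF.SigmaX R r≥2 K H co x v × FF.Zstar R r≥2 v) → W v)
                 × (W v → (FF.SigmaX R r≥2 K H co x v × FF.Zstar R r≥2 v))))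
lemma3 R _ _ _ _ _ _ _ _ _ _ _ _ K K-subfield _ _ _ coordinates H H-dim r≥2 =
  SigmaX-dim , FF.SpanFam R K zBasis , SpanFam-zBasis-dim , SigmaX∩Zstar⇔SpanFam-zBasis
  where open AndréBruckBose R r≥2 K-subfield coordinates H H-dim
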